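{- For all integers $a,b\geq 1$ there exists an $SMR(4b+2,(4a+1)(2b+1);4a+1,2)$.
   Context: A signed magic rectangle $SMR(m,n;r,s)$ is an $m\times n$ array, some of whose cells are filled with integers and the others empty, such that exactly $r$ cells in every row and exactly $s$ cells in every column are filled (so $mr=ns$), every element of $X$ appears exactly once in the array, and the sum of the entries of each row and of each column is zero, where (for $mr$ even) $X=\{\pm1,\pm2,\ldots,\pm mr/2\}$. -}

module Defs where

open import Data.Nat as ℕ using (ℕ)
open import Data.Integer as ℤ using (ℤ; +_; ∣_∣)
open import Data.Fin using (Fin; zero; suc)
open import Data.Maybe using (Maybe; just; nothing)
open import Data.Product using (Σ; ∃; _×_; _,_)
open import Relation.Binary.PropositionalEquality using (_≡_; _≢_)

sumℕ : (n : ℕ) → (Fin n → ℕ) → ℕ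
sumℕ ℕ.zero    f = 0
sumℕ (ℕ.suc n) f = f zero ℕ.+ sumℕ n (λ i → f (suc i))

sumℤ : (n : ℕ) → (Fin n → ℤ) → ℤ
sumℤ ℕ.zero    f = + 0
sumℤ (ℕ.suc n) f = f zero ℤ.+ sumℤ n (λ i → f (suc i))

Array : ℕ → ℕ → Set
Array m n = Fin m → Fin n → Maybe ℤ

filled : Maybe ℤ → ℕ
filled (just _) = 1
filled nothing  = 0

val : Maybe ℤ → ℤ
val (just x) = x
val nothing  = + 0

InX : ℕ → ℤ → Set
InX k x = (x ≢ + 0) × (∣ x ∣ ℕ.≤ k)

-- Signed magic rectangle SMR(m,n;r,s), for mr even, with X = {±1,…,±mr/2}.
record IsSMR (m n r s : ℕ) (A : Array m n) : Set where
  field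
    rowCount  : ∀ i → sumℕ n (λ j → filled (A i j)) ≡ r
    colCount  : ∀ j → sumℕ m (λ i → filled (A i j)) ≡ s
    entriesInX : ∀ i j x → A i j ≡ just x → InX (m ℕ.* r ℕ./ 2) x
    appearsOnce : ∀ x → InX (m ℕ.* r ℕ./ 2) x →
      Σ (Fin m × Fin n) λ { (i , j) → (A i j ≡ just x) ×
        (∀ i′ j′ → A i′ j′ ≡ just x → (i′ ≡ i) × (j′ ≡ j)) }
    rowSum    : ∀ i → sumℤ n (λ j → val (A i j)) ≡ + 0
    colSum    : ∀ j → sumℤ m (λ i → val (A i j)) ≡ + 0

SMR : (m n r s : ℕ) → Set
SMR m n r s = Σ (Array m n) (IsSMR m n r s)

-- A signed magic rectangle with two filled cells per column is the same thing as a list of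
-- columns, the j-th one carrying +j in one row and −j in another: column sums vanish and every
-- element of X occurs exactly once by construction, so it remains that every row meets r columns
-- and that in every row the labels entering with sign + and with sign − have the same sum.
--
-- With b = L + 1 the rows are six top rows and L blocks of four. For a = 1 an explicit list of
-- 10L + 15 columns works; it is assembled from segments that either join top rows or repeat one
-- pattern inside every block, so the label sums of a row are affine in L and in the row's block
-- index, and each balance condition becomes an identity between coefficients, decided by
-- computation. Each further unit of a appends a layer of quads x→y, y→x, y→x, x→y along a
-- perfect matching of the rows; a layer raises every degree by 4 and is balanced wherever it is
-- placed, because 1 + 4 = 2 + 3.
module Submission where

open import Defs
open import Data.Nat using (ℕ; _+_; _*_; _≥_)

open import Data.Bool using (Bool; true; false; _∧_; if_then_else_)
open import Data.Fin using (Fin; zero; suc; toℕ; fromℕ<)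
open import Data.Fin.Instances
open import Data.Fin.Patterns
open import Data.Fin.Properties using (toℕ<n; toℕ-fromℕ<; toℕ-injective; +↔⊎; *↔×)
open import Data.Integer as ℤ using (ℤ; +_; -[1+_])
import Data.Integer.Properties as ℤ
import Data.Integer.Tactic.RingSolver as ℤ-Solver
open import Data.List using (List; []; _∷_; [_]; _++_; length; lookup; map; concat; concatMap; tabulate; replicate)
open import Data.List.Membership.Propositional.Properties using (∈-lookup)
open import Data.List.Properties using (length-++; length-map)
open import Data.List.Relation.Unary.All as All using (All; all?; []; _∷_)
import Data.List.Relation.Unary.All.Properties as All
open import Data.Maybe using (Maybe; just; nothing)
open import Data.Nat using (zero; suc; _<_)
open import Data.Nat.DivMod using (_/_; m*n/n≡m)
import Data.Nat.Properties as ℕ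
open import Algebra.Properties.CommutativeSemigroup ℕ.+-commutativeSemigroup using (interchange)
open import Data.Nat.Tactic.RingSolver using (solve-∀)
open import Data.Product using (Σ; ∃-syntax; _×_; _,_; proj₁; proj₂; uncurry)
open import Data.Sum using (_⊎_; inj₁; inj₂; [_,_]′)
open import Data.Sum.Function.Propositional using (_⊎-↔_)
open import Function using (_∘_; mk⇔)
open import Function.Bundles using (Inverse; _↔_; mk↔ₛ′)
open import Function.Construct.Composition using (_↔-∘_)
open import Function.Construct.Identity using (↔-id)
open import Relation.Binary.Definitions using (DecidableEquality)
open import Relation.Binary.PropositionalEquality hiding ([_])
open import Relation.Binary.PropositionalEquality.Properties using (isDecEquivalence)
open import Relation.Binary.TypeClasses using (IsDecEquivalence; _≟_)
open import Relation.Nullary using (Dec; does; yes; no; contradiction)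
open import Relation.Nullary.Decidable using (does-⇔; map′; _×-dec_; ¬?; from-yes)

χ : Bool → ℕ
χ true  = 1
χ false = 0

χ-∧ : ∀ a b → χ (a ∧ b) ≡ χ a * χ b
χ-∧ true  b = sym (ℕ.+-identityʳ (χ b))
χ-∧ false b = refl

module _ {A : Set} {{_ : IsDecEquivalence {A = A} _≡_}} where

  δ : A → A → ℕ
  δ x y = χ (does (x ≟ y))

sumℕ-cong : ∀ n {f g : Fin n → ℕ} → (∀ j → f j ≡ g j) → sumℕ n f ≡ sumℕ n g
sumℕ-cong zero    f≗g = refl
sumℕ-cong (suc n) f≗g = cong₂ _+_ (f≗g zero) (sumℕ-cong n (f≗g ∘ suc))

sumℤ-cong : ∀ n {f g : Fin n → ℤ} → (∀ j → f j ≡ g j) → sumℤ n f ≡ sumℤ n g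
sumℤ-cong zero    f≗g = refl
sumℤ-cong (suc n) f≗g = cong₂ ℤ._+_ (f≗g zero) (sumℤ-cong n (f≗g ∘ suc))

sumℕ-zero : ∀ n → sumℕ n (λ _ → 0) ≡ 0
sumℕ-zero zero    = refl
sumℕ-zero (suc n) = sumℕ-zero n

sumℕ-+ : ∀ n (f g : Fin n → ℕ) → sumℕ n (λ j → f j + g j) ≡ sumℕ n f + sumℕ n g
sumℕ-+ zero    f g = refl
sumℕ-+ (suc n) f g = trans (cong (_+_ (f zero + g zero)) (sumℕ-+ n (f ∘ suc) (g ∘ suc)))
  (interchange (f zero) (g zero) _ _)

sumℕ-δ : ∀ {n} (i : Fin n) (h : Fin n → ℕ) → sumℕ n (λ j → δ i j * h j) ≡ h i
sumℕ-δ {suc n} zero    h =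
  trans (cong₂ _+_ (ℕ.+-identityʳ (h zero)) (sumℕ-zero n)) (ℕ.+-identityʳ (h zero))
sumℕ-δ {suc n} (suc i) h = sumℕ-δ i (h ∘ suc)

sumℤ-difference : ∀ n (f g : Fin n → ℕ) →
  sumℤ n (λ j → + f j ℤ.- + g j) ≡ + sumℕ n f ℤ.- + sumℕ n g
sumℤ-difference zero    f g = refl
sumℤ-difference (suc n) f g = begin
  + f zero ℤ.- + g zero ℤ.+ sumℤ n (λ j → + f (suc j) ℤ.- + g (suc j))
    ≡⟨ cong (ℤ._+_ (+ f zero ℤ.- + g zero)) (sumℤ-difference n (f ∘ suc) (g ∘ suc)) ⟩
  + f zero ℤ.- + g zero ℤ.+ (+ sumℕ n (f ∘ suc) ℤ.- + sumℕ n (g ∘ suc))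
    ≡⟨ regroup (+ f zero) (+ g zero) (+ sumℕ n (f ∘ suc)) (+ sumℕ n (g ∘ suc)) ⟩
  (+ f zero ℤ.+ + sumℕ n (f ∘ suc)) ℤ.- (+ g zero ℤ.+ + sumℕ n (g ∘ suc))
    ≡⟨ sym (cong₂ ℤ._-_ (ℤ.pos-+ (f zero) _) (ℤ.pos-+ (g zero) _)) ⟩
  + sumℕ (suc n) f ℤ.- + sumℕ (suc n) g ∎
  where
  open ≡-Reasoning
  regroup : ∀ a b c d → a ℤ.- b ℤ.+ (c ℤ.- d) ≡ (a ℤ.+ c) ℤ.- (b ℤ.+ d)
  regroup = ℤ-Solver.solve-∀

-- Degrees and label sums of lists

module _ {E : Set} where

  degree : (E → ℕ) → List E → ℕ
  degree c []       = 0
  degree c (x ∷ xs) = c x + degree c xs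

  labelSum : (E → ℕ) → ℕ → List E → ℕ
  labelSum c o []       = 0
  labelSum c o (x ∷ xs) = c x * suc o + labelSum c (suc o) xs

module _ {E : Set} where

  degree-++ : ∀ c (xs ys : List E) → degree c (xs ++ ys) ≡ degree c xs + degree c ys
  degree-++ c []       ys = refl
  degree-++ c (x ∷ xs) ys = trans (cong (_+_ (c x)) (degree-++ c xs ys)) (sym (ℕ.+-assoc (c x) _ _))

  labelSum-++ : ∀ c o (xs ys : List E) →
    labelSum c o (xs ++ ys) ≡ labelSum c o xs + labelSum c (o + length xs) ys
  labelSum-++ c o []       ys = cong (λ p → labelSum c p ys) (sym (ℕ.+-identityʳ o))
  labelSum-++ c o (x ∷ xs) ys = begin
    c x * suc o + labelSum c (suc o) (xs ++ ys)
      ≡⟨ cong (_+_ (c x * suc o)) (labelSum-++ c (suc o) xs ys) ⟩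
    c x * suc o + (labelSum c (suc o) xs + labelSum c (suc (o + length xs)) ys)
      ≡⟨ sym (ℕ.+-assoc (c x * suc o) _ _) ⟩
    c x * suc o + labelSum c (suc o) xs + labelSum c (suc (o + length xs)) ys
      ≡⟨ cong (λ p → labelSum c o (x ∷ xs) + labelSum c p ys) (sym (ℕ.+-suc o (length xs))) ⟩
    labelSum c o (x ∷ xs) + labelSum c (o + length (x ∷ xs)) ys ∎
    where open ≡-Reasoning

  labelSum-+ : ∀ c p o (xs : List E) → labelSum c (p + o) xs ≡ degree c xs * p + labelSum c o xs
  labelSum-+ c p o []       = refl
  labelSum-+ c p o (x ∷ xs) = begin
    c x * suc (p + o) + labelSum c (suc (p + o)) xs
      ≡⟨ cong (λ q → c x * suc (p + o) + labelSum c q xs) (sym (ℕ.+-suc p o)) ⟩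
    c x * suc (p + o) + labelSum c (p + suc o) xs
      ≡⟨ cong (_+_ (c x * suc (p + o))) (labelSum-+ c p (suc o) xs) ⟩
    c x * suc (p + o) + (degree c xs * p + labelSum c (suc o) xs)
      ≡⟨ regroup (c x) p o (degree c xs) (labelSum c (suc o) xs) ⟩
    (c x + degree c xs) * p + (c x * suc o + labelSum c (suc o) xs) ∎
    where
    open ≡-Reasoning
    regroup : ∀ a p o d s → a * suc (p + o) + (d * p + s) ≡ (a + d) * p + (a * suc o + s)
    regroup = solve-∀

  labelSum-offset : ∀ c o (xs : List E) → labelSum c o xs ≡ degree c xs * o + labelSum c 0 xs
  labelSum-offset c o xs = trans (cong (λ p → labelSum c p xs) (sym (ℕ.+-identityʳ o))) (labelSum-+ c o 0 xs)

  degree-cong : ∀ {c d} → (∀ x → c x ≡ d x) → (xs : List E) → degree c xs ≡ degree d xs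
  degree-cong c≗d []       = refl
  degree-cong c≗d (x ∷ xs) = cong₂ _+_ (c≗d x) (degree-cong c≗d xs)

  labelSum-cong : ∀ {c d} → (∀ x → c x ≡ d x) → ∀ o (xs : List E) → labelSum c o xs ≡ labelSum d o xs
  labelSum-cong c≗d o []       = refl
  labelSum-cong c≗d o (x ∷ xs) = cong₂ _+_ (cong (_* suc o) (c≗d x)) (labelSum-cong c≗d (suc o) xs)

  degree-scale : ∀ k c (xs : List E) → degree (λ x → k * c x) xs ≡ k * degree c xs
  degree-scale k c []       = sym (ℕ.*-zeroʳ k)
  degree-scale k c (x ∷ xs) = trans (cong (_+_ (k * c x)) (degree-scale k c xs)) (sym (ℕ.*-distribˡ-+ k _ _))

  labelSum-scale : ∀ k c o (xs : List E) → labelSum (λ x → k * c x) o xs ≡ k * labelSum c o xs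
  labelSum-scale k c o []       = sym (ℕ.*-zeroʳ k)
  labelSum-scale k c o (x ∷ xs) = trans
    (cong₂ _+_ (ℕ.*-assoc k (c x) (suc o)) (labelSum-scale k c (suc o) xs))
    (sym (ℕ.*-distribˡ-+ k _ _))

  degree-zero : ∀ (xs : List E) → degree (λ _ → 0) xs ≡ 0
  degree-zero []       = refl
  degree-zero (x ∷ xs) = degree-zero xs

  labelSum-zero : ∀ o (xs : List E) → labelSum (λ _ → 0) o xs ≡ 0
  labelSum-zero o []       = refl
  labelSum-zero o (x ∷ xs) = labelSum-zero (suc o) xs

  module _ {D : Set} (f : D → E) where

    degree-map : ∀ c (xs : List D) → degree c (map f xs) ≡ degree (c ∘ f) xs
    degree-map c []       = refl
    degree-map c (x ∷ xs) = cong (_+_ (c (f x))) (degree-map c xs)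

    labelSum-map : ∀ c o (xs : List D) → labelSum c o (map f xs) ≡ labelSum (c ∘ f) o xs
    labelSum-map c o []       = refl
    labelSum-map c o (x ∷ xs) = cong (_+_ (c (f x) * suc o)) (labelSum-map c (suc o) xs)

  length-concat-tabulate : ∀ w {n} (f : Fin n → List E) → (∀ j → length (f j) ≡ w) →
    length (concat (tabulate f)) ≡ n * w
  length-concat-tabulate w {zero}  f len = refl
  length-concat-tabulate w {suc n} f len = trans (length-++ (f zero))
    (cong₂ _+_ (len zero) (length-concat-tabulate w (f ∘ suc) (len ∘ suc)))

  degree-concat-tabulate : ∀ c {n} (f : Fin n → List E) →
    degree c (concat (tabulate f)) ≡ sumℕ n (λ j → degree c (f j))
  degree-concat-tabulate c {zero}  f = refl
  degree-concat-tabulate c {suc n} f = trans (degree-++ c (f zero) _)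
    (cong (_+_ (degree c (f zero))) (degree-concat-tabulate c (f ∘ suc)))

  labelSum-concat-tabulate : ∀ c w {n} (f : Fin n → List E) → (∀ j → length (f j) ≡ w) → ∀ o →
    labelSum c o (concat (tabulate f)) ≡ sumℕ n (λ j → labelSum c (o + w * toℕ j) (f j))
  labelSum-concat-tabulate c w {zero}  f len o = refl
  labelSum-concat-tabulate c w {suc n} f len o = trans (labelSum-++ c o (f zero) _) (cong₂ _+_
    (cong (λ p → labelSum c p (f zero)) (sym (trans (cong (_+_ o) (ℕ.*-zeroʳ w)) (ℕ.+-identityʳ o))))
    (trans (cong (λ p → labelSum c (o + p) (concat (tabulate (f ∘ suc)))) (len zero))
      (trans (labelSum-concat-tabulate c w (f ∘ suc) (len ∘ suc) (o + w))
        (sumℕ-cong n (λ j → cong (λ p → labelSum c p (f (suc j))) (shift o w (toℕ j)))))))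
    where
    shift : ∀ o w t → o + w + w * t ≡ o + w * suc t
    shift = solve-∀

  length-concat-replicate : ∀ k (xs : List E) → length (concat (replicate k xs)) ≡ k * length xs
  length-concat-replicate zero    xs = refl
  length-concat-replicate (suc k) xs = trans (length-++ xs) (cong (_+_ (length xs)) (length-concat-replicate k xs))

  degree-concat-replicate : ∀ c k (xs : List E) → degree c (concat (replicate k xs)) ≡ k * degree c xs
  degree-concat-replicate c zero    xs = refl
  degree-concat-replicate c (suc k) xs =
    trans (degree-++ c xs _) (cong (_+_ (degree c xs)) (degree-concat-replicate c k xs))

  labelSum-concat-replicate : ∀ {c d} (xs : List E) → (∀ o → labelSum c o xs ≡ labelSum d o xs) →
    ∀ k o → labelSum c o (concat (replicate k xs)) ≡ labelSum d o (concat (replicate k xs))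
  labelSum-concat-replicate xs balanced zero    o = refl
  labelSum-concat-replicate {c} {d} xs balanced (suc k) o = begin
    labelSum c o (xs ++ concat (replicate k xs))
      ≡⟨ labelSum-++ c o xs _ ⟩
    labelSum c o xs + labelSum c (o + length xs) (concat (replicate k xs))
      ≡⟨ cong₂ _+_ (balanced o) (labelSum-concat-replicate xs balanced k (o + length xs)) ⟩
    labelSum d o xs + labelSum d (o + length xs) (concat (replicate k xs))
      ≡⟨ sym (labelSum-++ d o xs _) ⟩
    labelSum d o (xs ++ concat (replicate k xs)) ∎
    where open ≡-Reasoning

  sumℕ-lookup-degree : ∀ c (xs : List E) → sumℕ (length xs) (c ∘ lookup xs) ≡ degree c xs
  sumℕ-lookup-degree c []       = refl
  sumℕ-lookup-degree c (x ∷ xs) = cong (_+_ (c x)) (sumℕ-lookup-degree c xs)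

  sumℕ-lookup-labelSum : ∀ c o (xs : List E) →
    sumℕ (length xs) (λ j → c (lookup xs j) * suc (o + toℕ j)) ≡ labelSum c o xs
  sumℕ-lookup-labelSum c o []       = refl
  sumℕ-lookup-labelSum c o (x ∷ xs) = cong₂ _+_
    (cong (λ p → c x * suc p) (ℕ.+-identityʳ o))
    (trans (sumℕ-cong (length xs) (λ j → cong (λ p → c (lookup xs j) * suc p) (ℕ.+-suc o (toℕ j))))
           (sumℕ-lookup-labelSum c (suc o) xs))

data Polarity : Set where
  plus minus : Polarity

-- The rows holding the two signed copies of a column's label; as a function of the sign,
-- renaming the rows of a column is composition.
Column : Set → Set
Column R = Polarity → R

infix 6 _⟶_
_⟶_ : ∀ {R : Set} → R → R → Column R
(p ⟶ q) plus  = p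
(p ⟶ q) minus = q

Loopless : ∀ {R : Set} → Column R → Set
Loopless e = e plus ≢ e minus

signed : Polarity → ℕ → ℤ
signed plus  v = + v
signed minus v = ℤ.- + v

signed-injective : ∀ {s s′ a b} → signed s (suc a) ≡ signed s′ (suc b) → s ≡ s′ × a ≡ b
signed-injective {plus}  {plus}  refl = refl , refl
signed-injective {minus} {minus} refl = refl , refl

signed-InX : ∀ s {t k} → t < k → InX k (signed s (suc t))
signed-InX plus  t<k = (λ ()) , t<k
signed-InX minus t<k = (λ ()) , t<k

InX⇒signed : ∀ {k} x → InX k x → ∃[ s ] ∃[ t ] (t < k × x ≡ signed s (suc t))
InX⇒signed (+ zero)  (x≢0 , _) = contradiction refl x≢0
InX⇒signed (+ suc t) (_ , t<k) = plus , t , t<k , refl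
InX⇒signed -[1+ t ]   (_ , t<k) = minus , t , t<k , refl

module _ {R : Set} {{_ : IsDecEquivalence {A = R} _≡_}} where

  incidence : Polarity → R → Column R → ℕ
  incidence s ρ e = δ ρ (e s)

  cell : R → Column R → ℕ → Maybe ℤ
  cell ρ e v =
    if does (ρ ≟ e plus) then just (signed plus v)
    else if does (ρ ≟ e minus) then just (signed minus v)
    else nothing

  filled-cell : ∀ ρ e v → Loopless e → filled (cell ρ e v) ≡ incidence plus ρ e + incidence minus ρ e
  filled-cell ρ e v p≢q with ρ ≟ e plus | ρ ≟ e minus
  ... | yes ρ≡p | yes ρ≡q = contradiction (trans (sym ρ≡p) ρ≡q) p≢q
  ... | yes _   | no _    = refl
  ... | no _    | yes _   = refl
  ... | no _    | no _    = refl

  val-cell : ∀ ρ e v → Loopless e →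
    val (cell ρ e v) ≡ + (incidence plus ρ e * v) ℤ.- + (incidence minus ρ e * v)
  val-cell ρ e v p≢q with ρ ≟ e plus | ρ ≟ e minus
  ... | yes ρ≡p | yes ρ≡q = contradiction (trans (sym ρ≡p) ρ≡q) p≢q
  ... | yes _   | no _    = cong +_ (sym (trans (ℕ.+-identityʳ _) (ℕ.+-identityʳ v)))
  ... | no _    | yes _   = sym (trans (ℤ.+-identityˡ _) (cong (ℤ.-_ ∘ +_) (ℕ.+-identityʳ v)))
  ... | no _    | no _    = refl

  cell-just : ∀ ρ e v {x} → cell ρ e v ≡ just x → ∃[ s ] (ρ ≡ e s × x ≡ signed s v)
  cell-just ρ e v eq with ρ ≟ e plus | ρ ≟ e minus | eq
  ... | yes ρ≡p | _       | refl = plus , ρ≡p , refl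
  ... | no _    | yes ρ≡q | refl = minus , ρ≡q , refl

  cell-at : ∀ s e v → Loopless e → cell (e s) e v ≡ just (signed s v)
  cell-at plus e v p≢q with e plus ≟ e plus
  ... | yes _  = refl
  ... | no p≢p = contradiction refl p≢p
  cell-at minus e v p≢q with e minus ≟ e plus | e minus ≟ e minus
  ... | yes q≡p | _      = contradiction (sym q≡p) p≢q
  ... | no _    | yes _  = refl
  ... | no _    | no q≢q = contradiction refl q≢q

-- From columns to signed magic rectangles

module _ {m : ℕ} {R : Set} {{_ : IsDecEquivalence {A = R} _≡_}} (ι : Fin m ↔ R) where
  open Inverse ι

  private
    δ-to : ∀ i x → δ (to i) x ≡ δ (from x) i
    δ-to i x = cong χ (does-⇔ (mk⇔ (λ eq → inverseʳ (sym eq)) (λ eq → inverseˡ (sym eq)))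
      (to i ≟ x) (from x ≟ i))

    sumℕ-δ-to : ∀ x h → sumℕ m (λ i → δ (to i) x * h) ≡ h
    sumℕ-δ-to x h = trans (sumℕ-cong m (λ i → cong (_* h) (δ-to i x))) (sumℕ-δ (from x) (λ _ → h))

    sumℕ-δ-to₁ : ∀ x → sumℕ m (λ i → δ (to i) x) ≡ 1
    sumℕ-δ-to₁ x = trans (sumℕ-cong m (λ i → sym (ℕ.*-identityʳ _))) (sumℕ-δ-to x 1)

  module _ (r : ℕ) (cols : List (Column R)) (loopless-cols : All Loopless cols)
    (regular : ∀ ρ → degree (incidence plus ρ) cols + degree (incidence minus ρ) cols ≡ r)
    (balanced : ∀ ρ → labelSum (incidence plus ρ) 0 cols ≡ labelSum (incidence minus ρ) 0 cols)
    (size : m * r ≡ length cols * 2)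
    where

    private
      n : ℕ
      n = length cols

      column : Fin n → Column R
      column = lookup cols

      label : Fin n → ℕ
      label j = suc (toℕ j)

      loopless : ∀ j → Loopless (column j)
      loopless j = All.lookup loopless-cols (∈-lookup j)

      A : Array m n
      A i j = cell (to i) (column j) (label j)

      bound : m * r / 2 ≡ n
      bound = trans (cong (_/ 2) size) (m*n/n≡m n 2)

      rowCount : ∀ i → sumℕ n (λ j → filled (A i j)) ≡ r
      rowCount i = begin
        sumℕ n (λ j → filled (A i j))
          ≡⟨ sumℕ-cong n (λ j → filled-cell ρ (column j) (label j) (loopless j)) ⟩
        sumℕ n (λ j → incidence plus ρ (column j) + incidence minus ρ (column j))
          ≡⟨ sumℕ-+ n _ _ ⟩
        sumℕ n (incidence plus ρ ∘ column) + sumℕ n (incidence minus ρ ∘ column)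
          ≡⟨ cong₂ _+_ (sumℕ-lookup-degree _ cols) (sumℕ-lookup-degree _ cols) ⟩
        degree (incidence plus ρ) cols + degree (incidence minus ρ) cols
          ≡⟨ regular ρ ⟩
        r ∎
        where
        open ≡-Reasoning
        ρ : R
        ρ = to i

      colCount : ∀ j → sumℕ m (λ i → filled (A i j)) ≡ 2
      colCount j = begin
        sumℕ m (λ i → filled (A i j))
          ≡⟨ sumℕ-cong m (λ i → filled-cell (to i) (column j) (label j) (loopless j)) ⟩
        sumℕ m (λ i → δ (to i) (column j plus) + δ (to i) (column j minus))
          ≡⟨ sumℕ-+ m _ _ ⟩
        sumℕ m (λ i → δ (to i) (column j plus)) + sumℕ m (λ i → δ (to i) (column j minus))
          ≡⟨ cong₂ _+_ (sumℕ-δ-to₁ _) (sumℕ-δ-to₁ _) ⟩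
        2 ∎
        where open ≡-Reasoning

      rowSum : ∀ i → sumℤ n (λ j → val (A i j)) ≡ + 0
      rowSum i = begin
        sumℤ n (λ j → val (A i j))
          ≡⟨ sumℤ-cong n (λ j → val-cell ρ (column j) (label j) (loopless j)) ⟩
        sumℤ n (λ j → + (incidence plus ρ (column j) * label j) ℤ.- + (incidence minus ρ (column j) * label j))
          ≡⟨ sumℤ-difference n _ _ ⟩
        + sumℕ n (λ j → incidence plus ρ (column j) * label j) ℤ.-
          + sumℕ n (λ j → incidence minus ρ (column j) * label j)
          ≡⟨ cong₂ (λ a b → + a ℤ.- + b) (sumℕ-lookup-labelSum _ 0 cols) (sumℕ-lookup-labelSum _ 0 cols) ⟩
        + labelSum (incidence plus ρ) 0 cols ℤ.- + N
          ≡⟨ cong (λ a → + a ℤ.- + N) (balanced ρ) ⟩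
        + N ℤ.- + N
          ≡⟨ ℤ.+-inverseʳ (+ N) ⟩
        + 0 ∎
        where
        open ≡-Reasoning
        ρ : R
        ρ = to i
        N : ℕ
        N = labelSum (incidence minus ρ) 0 cols

      colSum : ∀ j → sumℤ m (λ i → val (A i j)) ≡ + 0
      colSum j = begin
        sumℤ m (λ i → val (A i j))
          ≡⟨ sumℤ-cong m (λ i → val-cell (to i) (column j) (label j) (loopless j)) ⟩
        sumℤ m (λ i → + (δ (to i) (column j plus) * label j) ℤ.- + (δ (to i) (column j minus) * label j))
          ≡⟨ sumℤ-difference m _ _ ⟩
        + sumℕ m (λ i → δ (to i) (column j plus) * label j) ℤ.-
          + sumℕ m (λ i → δ (to i) (column j minus) * label j)
          ≡⟨ cong₂ (λ a b → + a ℤ.- + b) (sumℕ-δ-to _ _) (sumℕ-δ-to _ _) ⟩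
        + label j ℤ.- + label j
          ≡⟨ ℤ.+-inverseʳ (+ label j) ⟩
        + 0 ∎
        where open ≡-Reasoning

      entriesInX : ∀ i j x → A i j ≡ just x → InX (m * r / 2) x
      entriesInX i j x eq with cell-just (to i) (column j) (label j) eq
      ... | s , _ , refl = signed-InX s (subst (toℕ j <_) (sym bound) (toℕ<n j))

      appearsOnce : ∀ x → InX (m * r / 2) x →
        Σ (Fin m × Fin n) λ p → (A (proj₁ p) (proj₂ p) ≡ just x) ×
          (∀ i′ j′ → A i′ j′ ≡ just x → (i′ ≡ proj₁ p) × (j′ ≡ proj₂ p))
      appearsOnce x x∈X with InX⇒signed x x∈X
      ... | s , t , t<k , refl = (from (column j s) , j) , hit , unique
        where
        t<n : t < n
        t<n = subst (t <_) bound t<k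
        j : Fin n
        j = fromℕ< t<n
        hit : A (from (column j s)) j ≡ just (signed s (suc t))
        hit = trans (cong₂ (λ ρ v → cell ρ (column j) (suc v)) (strictlyInverseˡ _) (toℕ-fromℕ< t<n))
                    (cell-at s (column j) _ (loopless j))
        unique : ∀ i′ j′ → A i′ j′ ≡ just (signed s (suc t)) → i′ ≡ from (column j s) × j′ ≡ j
        unique i′ j′ eq with cell-just (to i′) (column j′) (label j′) eq
        ... | s′ , to-i′≡ , x≡ with signed-injective {s} {s′} x≡
        ... | refl , t≡ = i′≡ , j′≡
          where
          j′≡ : j′ ≡ j
          j′≡ = toℕ-injective (trans (sym t≡) (sym (toℕ-fromℕ< t<n)))
          i′≡ : i′ ≡ from (column j s)
          i′≡ = trans (sym (strictlyInverseʳ i′)) (cong from (trans to-i′≡ (cong (λ k → column k s) j′≡)))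

    columns⇒SMR : SMR m (length cols) r 2
    columns⇒SMR = A , record
      { rowCount    = rowCount
      ; colCount    = colCount
      ; entriesInX  = entriesInX
      ; appearsOnce = appearsOnce
      ; rowSum      = rowSum
      ; colSum      = colSum
      }

-- Affine functions of the number L of blocks and of the block index i of a row.
record LinForm : Set where
  constructor lin
  field
    constant perBlock perIndex : ℕ

⟦_⟧ : LinForm → ℕ → ℕ → ℕ
⟦ lin a b c ⟧ L i = a + b * L + c * i

infixl 6 _⊕_
infixr 7 _⊛_

_⊕_ : LinForm → LinForm → LinForm
lin a b c ⊕ lin a′ b′ c′ = lin (a + a′) (b + b′) (c + c′)

_⊛_ : ℕ → LinForm → LinForm
k ⊛ lin a b c = lin (k * a) (k * b) (k * c)

num : ℕ → LinForm
num n = lin n 0 0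

⟦⊕⟧ : ∀ x y L t → ⟦ x ⊕ y ⟧ L t ≡ ⟦ x ⟧ L t + ⟦ y ⟧ L t
⟦⊕⟧ (lin a b c) (lin a′ b′ c′) = distrib a b c a′ b′ c′
  where
  distrib : ∀ a b c a′ b′ c′ L t →
    a + a′ + (b + b′) * L + (c + c′) * t ≡ a + b * L + c * t + (a′ + b′ * L + c′ * t)
  distrib = solve-∀

⟦⊛⟧ : ∀ k x L t → ⟦ k ⊛ x ⟧ L t ≡ k * ⟦ x ⟧ L t
⟦⊛⟧ k (lin a b c) = distrib k a b c
  where
  distrib : ∀ k a b c L t → k * a + k * b * L + k * c * t ≡ k * (a + b * L + c * t)
  distrib = solve-∀

⟦num⟧ : ∀ n L t → ⟦ num n ⟧ L t ≡ n
⟦num⟧ n L t = trans (ℕ.+-identityʳ (n + 0)) (ℕ.+-identityʳ n)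

⟦⊛⊕num⟧ : ∀ k x n L t → ⟦ k ⊛ x ⊕ num n ⟧ L t ≡ k * ⟦ x ⟧ L t + n
⟦⊛⊕num⟧ k x n L t = trans (⟦⊕⟧ (k ⊛ x) (num n) L t) (cong₂ _+_ (⟦⊛⟧ k x L t) (⟦num⟧ n L t))

-- Rows, segments and their symbolic label sums

data Row (L : ℕ) : Set where
  top : Fin 6 → Row L
  blk : Fin L → Fin 4 → Row L

module _ {L : ℕ} where

  top-injective : ∀ {k k′} → top {L} k ≡ top k′ → k ≡ k′
  top-injective refl = refl

  blk-injective : ∀ {i j : Fin L} {g h} → blk i g ≡ blk j h → i ≡ j × g ≡ h
  blk-injective refl = refl , refl

  -- Written out so that equality of rows computes through equality of their indices, which
  -- incidence-blk and the evaluations in the construction rely on.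
  _≟-Row_ : DecidableEquality (Row L)
  top k   ≟-Row top k′  = map′ (cong top) top-injective (k ≟ k′)
  top _   ≟-Row blk _ _ = no λ ()
  blk _ _ ≟-Row top _   = no λ ()
  blk i g ≟-Row blk j h = map′ (uncurry (cong₂ blk)) blk-injective (i ≟ j ×-dec g ≟ h)

  instance
    Row-≡-isDecEquivalence : IsDecEquivalence {A = Row L} _≡_
    Row-≡-isDecEquivalence = isDecEquivalence _≟-Row_

  rows : Fin (6 + L * 4) ↔ Row L
  rows = ⊎↔Row ↔-∘ ((↔-id (Fin 6) ⊎-↔ *↔×) ↔-∘ +↔⊎)
    where
    ⊎↔Row : (Fin 6 ⊎ (Fin L × Fin 4)) ↔ Row L
    ⊎↔Row = mk↔ₛ′ [ top , uncurry blk ]′ (λ { (top k) → inj₁ k ; (blk i g) → inj₂ (i , g) })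
      (λ { (top _) → refl ; (blk _ _) → refl }) (λ { (inj₁ _) → refl ; (inj₂ _) → refl })

data Segment : Set where
  tops   : List (Column (Fin 6)) → Segment
  blocks : List (Column (Fin 4)) → Segment

module _ (L : ℕ) where

  segmentColumns : Segment → List (Column (Row L))
  segmentColumns (tops es)   = map (top ∘_) es
  segmentColumns (blocks es) = concat (tabulate λ i → map (blk i ∘_) es)

  columns : List Segment → List (Column (Row L))
  columns = concatMap segmentColumns

width : Segment → LinForm
width (tops es)   = lin (length es) 0 0
width (blocks es) = lin 0 (length es) 0

totalWidth : List Segment → LinForm
totalWidth []       = num 0
totalWidth (σ ∷ σs) = width σ ⊕ totalWidth σs

module _ {L : ℕ} where

  blockIndex : Row L → ℕ
  blockIndex (top _)   = 0
  blockIndex (blk i _) = toℕ i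

  symbolicDegree : Polarity → Row L → Segment → ℕ
  symbolicDegree s (top k)   (tops es)   = degree (incidence s k) es
  symbolicDegree s (blk _ g) (blocks es) = degree (incidence s g) es
  symbolicDegree _ _         _           = 0

  symbolicLabelSum : Polarity → Row L → LinForm → Segment → LinForm
  symbolicLabelSum s (top k) o (tops es) =
    degree (incidence s k) es ⊛ o ⊕ num (labelSum (incidence s k) 0 es)
  symbolicLabelSum s (blk _ g) o (blocks es) =
    degree (incidence s g) es ⊛ (o ⊕ lin 0 0 (length es)) ⊕ num (labelSum (incidence s g) 0 es)
  symbolicLabelSum _ _ _ _ = num 0

  symbolicLabelSums : Polarity → Row L → LinForm → List Segment → LinForm
  symbolicLabelSums s ρ o []       = num 0
  symbolicLabelSums s ρ o (σ ∷ σs) = symbolicLabelSum s ρ o σ ⊕ symbolicLabelSums s ρ (o ⊕ width σ) σs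

  incidence-blk : ∀ s (i : Fin L) g j (e : Column (Fin 4)) →
    incidence s (blk i g) (blk j ∘ e) ≡ δ i j * incidence s g e
  incidence-blk s i g j e = χ-∧ (does (i ≟ j)) (does (g ≟ e s))

  private
    blockColumns : ∀ (es : List (Column (Fin 4))) (j : Fin L) → List (Column (Row L))
    blockColumns es j = map (blk j ∘_) es

  degree-blocks : ∀ c es →
    degree c (segmentColumns L (blocks es)) ≡ sumℕ L (λ j → degree (c ∘ (blk j ∘_)) es)
  degree-blocks c es = trans (degree-concat-tabulate c (blockColumns es))
    (sumℕ-cong L (λ j → degree-map (blk j ∘_) c es))

  labelSum-blocks : ∀ c o es → labelSum c o (segmentColumns L (blocks es)) ≡
    sumℕ L (λ j → labelSum (c ∘ (blk j ∘_)) (o + length es * toℕ j) es)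
  labelSum-blocks c o es =
    trans (labelSum-concat-tabulate c (length es) (blockColumns es) (λ j → length-map (blk j ∘_) es) o)
      (sumℕ-cong L (λ j → labelSum-map (blk j ∘_) c _ es))

  length-segmentColumns : ∀ σ t → length (segmentColumns L σ) ≡ ⟦ width σ ⟧ L t
  length-segmentColumns (tops es)   t = trans (length-map (top ∘_) es) (sym (⟦num⟧ (length es) L t))
  length-segmentColumns (blocks es) t =
    trans (length-concat-tabulate (length es) (blockColumns es) (λ j → length-map (blk j ∘_) es))
      (sym (trans (ℕ.+-identityʳ _) (ℕ.*-comm (length es) L)))

  length-columns : ∀ σs t → length (columns L σs) ≡ ⟦ totalWidth σs ⟧ L t
  length-columns []       t = refl
  length-columns (σ ∷ σs) t = trans (length-++ (segmentColumns L σ))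
    (trans (cong₂ _+_ (length-segmentColumns σ t) (length-columns σs t)) (sym (⟦⊕⟧ (width σ) _ L t)))

  degree-segmentColumns : ∀ s ρ σ → degree (incidence s ρ) (segmentColumns L σ) ≡ symbolicDegree s ρ σ
  degree-segmentColumns s (top k)   (tops es)   = degree-map (top ∘_) _ es
  degree-segmentColumns s (blk i g) (tops es)   = trans (degree-map (top ∘_) _ es) (degree-zero es)
  degree-segmentColumns s (top k)   (blocks es) = trans (degree-blocks _ es)
    (trans (sumℕ-cong L (λ _ → degree-zero es)) (sumℕ-zero L))
  degree-segmentColumns s (blk i g) (blocks es) = trans (degree-blocks _ es)
    (trans (sumℕ-cong L (λ j → trans (degree-cong (incidence-blk s i g j) es) (degree-scale (δ i j) _ es)))
      (sumℕ-δ i _))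

  degree-columns : ∀ s ρ σs → degree (incidence s ρ) (columns L σs) ≡ degree (symbolicDegree s ρ) σs
  degree-columns s ρ []       = refl
  degree-columns s ρ (σ ∷ σs) = trans (degree-++ _ (segmentColumns L σ) _)
    (cong₂ _+_ (degree-segmentColumns s ρ σ) (degree-columns s ρ σs))

  labelSum-segmentColumns : ∀ s ρ o σ →
    labelSum (incidence s ρ) (⟦ o ⟧ L (blockIndex ρ)) (segmentColumns L σ) ≡
    ⟦ symbolicLabelSum s ρ o σ ⟧ L (blockIndex ρ)
  labelSum-segmentColumns s (top k) o (tops es) = trans (labelSum-map (top ∘_) _ _ es)
    (trans (labelSum-offset (incidence s k) _ es) (sym (⟦⊛⊕num⟧ (degree (incidence s k) es) o _ L 0)))
  labelSum-segmentColumns s (blk i g) o (tops es) = trans (labelSum-map (top ∘_) _ _ es) (labelSum-zero _ es)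
  labelSum-segmentColumns s (top k) o (blocks es) = trans (labelSum-blocks _ _ es)
    (trans (sumℕ-cong L (λ _ → labelSum-zero _ es)) (sumℕ-zero L))
  labelSum-segmentColumns s (blk i g) o (blocks es) = begin
    labelSum (incidence s (blk i g)) o′ (segmentColumns L (blocks es))
      ≡⟨ labelSum-blocks _ o′ es ⟩
    sumℕ L (λ j → labelSum (incidence s (blk i g) ∘ (blk j ∘_)) (o′ + w * toℕ j) es)
      ≡⟨ sumℕ-cong L (λ j → trans (labelSum-cong (incidence-blk s i g j) _ es) (labelSum-scale (δ i j) _ _ es)) ⟩
    sumℕ L (λ j → δ i j * labelSum (incidence s g) (o′ + w * toℕ j) es)
      ≡⟨ sumℕ-δ i _ ⟩
    labelSum (incidence s g) (o′ + w * toℕ i) es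
      ≡⟨ labelSum-offset _ _ es ⟩
    d * (o′ + w * toℕ i) + labelSum (incidence s g) 0 es
      ≡⟨ cong (λ p → d * p + labelSum (incidence s g) 0 es) (sym (⟦⊕⟧ o (lin 0 0 w) L (toℕ i))) ⟩
    d * ⟦ o ⊕ lin 0 0 w ⟧ L (toℕ i) + labelSum (incidence s g) 0 es
      ≡⟨ sym (⟦⊛⊕num⟧ d (o ⊕ lin 0 0 w) _ L (toℕ i)) ⟩
    ⟦ symbolicLabelSum s (blk i g) o (blocks es) ⟧ L (toℕ i) ∎
    where
    open ≡-Reasoning
    o′ w d : ℕ
    o′ = ⟦ o ⟧ L (toℕ i)
    w = length es
    d = degree (incidence s g) es

  labelSum-columns : ∀ s ρ o σs →
    labelSum (incidence s ρ) (⟦ o ⟧ L (blockIndex ρ)) (columns L σs) ≡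
    ⟦ symbolicLabelSums s ρ o σs ⟧ L (blockIndex ρ)
  labelSum-columns s ρ o []       = refl
  labelSum-columns s ρ o (σ ∷ σs) = begin
    labelSum c o′ (segmentColumns L σ ++ columns L σs)
      ≡⟨ labelSum-++ c o′ (segmentColumns L σ) _ ⟩
    labelSum c o′ (segmentColumns L σ) + labelSum c (o′ + length (segmentColumns L σ)) (columns L σs)
      ≡⟨ cong (λ p → labelSum c o′ (segmentColumns L σ) + labelSum c p (columns L σs)) next-offset ⟩
    labelSum c o′ (segmentColumns L σ) + labelSum c (⟦ o ⊕ width σ ⟧ L t) (columns L σs)
      ≡⟨ cong₂ _+_ (labelSum-segmentColumns s ρ o σ) (labelSum-columns s ρ (o ⊕ width σ) σs) ⟩
    ⟦ symbolicLabelSum s ρ o σ ⟧ L t + ⟦ symbolicLabelSums s ρ (o ⊕ width σ) σs ⟧ L t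
      ≡⟨ sym (⟦⊕⟧ (symbolicLabelSum s ρ o σ) (symbolicLabelSums s ρ (o ⊕ width σ) σs) L t) ⟩
    ⟦ symbolicLabelSums s ρ o (σ ∷ σs) ⟧ L t ∎
    where
    open ≡-Reasoning
    c : Column (Row L) → ℕ
    c = incidence s ρ
    t o′ : ℕ
    t = blockIndex ρ
    o′ = ⟦ o ⟧ L t
    next-offset : o′ + length (segmentColumns L σ) ≡ ⟦ o ⊕ width σ ⟧ L t
    next-offset = trans (cong (_+_ o′) (length-segmentColumns σ t)) (sym (⟦⊕⟧ o (width σ) L t))

-- The construction

quad : ∀ {R : Set} → R → R → List (Column R)
quad x y = x ⟶ y ∷ y ⟶ x ∷ y ⟶ x ∷ x ⟶ y ∷ []

base : List Segment
base =
  blocks [ 1F ⟶ 2F ] ∷ blocks [ 1F ⟶ 0F ] ∷ blocks [ 2F ⟶ 0F ] ∷ blocks [ 3F ⟶ 2F ] ∷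
  tops (0F ⟶ 1F ∷ 1F ⟶ 0F ∷ 1F ⟶ 0F ∷ 2F ⟶ 3F ∷ 1F ⟶ 0F ∷ 2F ⟶ 3F ∷ 4F ⟶ 5F ∷ 4F ⟶ 5F ∷ []) ∷
  blocks [ 3F ⟶ 1F ] ∷ blocks [ 0F ⟶ 2F ] ∷ blocks (0F ⟶ 1F ∷ 2F ⟶ 3F ∷ []) ∷
  tops (0F ⟶ 1F ∷ 4F ⟶ 5F ∷ 3F ⟶ 2F ∷ 5F ⟶ 4F ∷ 5F ⟶ 4F ∷ 3F ⟶ 2F ∷ 2F ⟶ 3F ∷ []) ∷
  blocks [ 3F ⟶ 0F ] ∷ blocks [ 1F ⟶ 3F ] ∷ []

layer : List Segment
layer = tops (quad 0F 1F ++ quad 2F 3F ++ quad 4F 5F) ∷ blocks (quad 0F 1F ++ quad 2F 3F) ∷ []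

-- The symbolic sums depend on a row only through its top index or its position g inside a
-- block, and on the offset o identically on both sides of layer-balanced, so these identities
-- hold by evaluation.
module _ {L : ℕ} where

  base-degree : ∀ (ρ : Row L) →
    degree (symbolicDegree plus ρ) base + degree (symbolicDegree minus ρ) base ≡ 5
  base-degree (top 0F)   = refl
  base-degree (top 1F)   = refl
  base-degree (top 2F)   = refl
  base-degree (top 3F)   = refl
  base-degree (top 4F)   = refl
  base-degree (top 5F)   = refl
  base-degree (blk _ 0F) = refl
  base-degree (blk _ 1F) = refl
  base-degree (blk _ 2F) = refl
  base-degree (blk _ 3F) = refl

  base-balanced : ∀ (ρ : Row L) →
    symbolicLabelSums plus ρ (num 0) base ≡ symbolicLabelSums minus ρ (num 0) base
  base-balanced (top 0F)   = refl
  base-balanced (top 1F)   = refl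
  base-balanced (top 2F)   = refl
  base-balanced (top 3F)   = refl
  base-balanced (top 4F)   = refl
  base-balanced (top 5F)   = refl
  base-balanced (blk _ 0F) = refl
  base-balanced (blk _ 1F) = refl
  base-balanced (blk _ 2F) = refl
  base-balanced (blk _ 3F) = refl

  layer-degree : ∀ (ρ : Row L) →
    degree (symbolicDegree plus ρ) layer + degree (symbolicDegree minus ρ) layer ≡ 4
  layer-degree (top 0F)   = refl
  layer-degree (top 1F)   = refl
  layer-degree (top 2F)   = refl
  layer-degree (top 3F)   = refl
  layer-degree (top 4F)   = refl
  layer-degree (top 5F)   = refl
  layer-degree (blk _ 0F) = refl
  layer-degree (blk _ 1F) = refl
  layer-degree (blk _ 2F) = refl
  layer-degree (blk _ 3F) = refl

  layer-balanced : ∀ (ρ : Row L) o →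
    symbolicLabelSums plus ρ o layer ≡ symbolicLabelSums minus ρ o layer
  layer-balanced (top 0F)   o = refl
  layer-balanced (top 1F)   o = refl
  layer-balanced (top 2F)   o = refl
  layer-balanced (top 3F)   o = refl
  layer-balanced (top 4F)   o = refl
  layer-balanced (top 5F)   o = refl
  layer-balanced (blk _ 0F) o = refl
  layer-balanced (blk _ 1F) o = refl
  layer-balanced (blk _ 2F) o = refl
  layer-balanced (blk _ 3F) o = refl

SegmentLoopless : Segment → Set
SegmentLoopless (tops es)   = All Loopless es
SegmentLoopless (blocks es) = All Loopless es

segmentLoopless? : ∀ σ → Dec (SegmentLoopless σ)
segmentLoopless? (tops es)   = all? (λ e → ¬? (e plus ≟ e minus)) es
segmentLoopless? (blocks es) = all? (λ e → ¬? (e plus ≟ e minus)) es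

segmentColumns-loopless : ∀ {L} σ → SegmentLoopless σ → All Loopless (segmentColumns L σ)
segmentColumns-loopless (tops es)   p = All.map⁺ (All.map (λ p≢q → p≢q ∘ top-injective) p)
segmentColumns-loopless (blocks es) p = All.concat⁺ (All.tabulate⁺ {f = λ j → map (blk j ∘_) es} λ j →
  All.map⁺ (All.map (λ p≢q → p≢q ∘ proj₂ ∘ blk-injective) p))

columns-loopless : ∀ {L} σs → All SegmentLoopless σs → All Loopless (columns L σs)
columns-loopless []       []       = []
columns-loopless (σ ∷ σs) (p ∷ ps) = All.++⁺ (segmentColumns-loopless σ p) (columns-loopless σs ps)

module _ (L a′ : ℕ) where

  smrColumns : List (Column (Row L))
  smrColumns = columns L base ++ concat (replicate a′ (columns L layer))

  smrColumns-loopless : All Loopless smrColumns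
  smrColumns-loopless = All.++⁺ (columns-loopless base (from-yes (all? segmentLoopless? base)))
    (All.concat⁺ (All.replicate⁺ a′ (columns-loopless layer (from-yes (all? segmentLoopless? layer)))))

  smrColumns-length : length smrColumns ≡ 15 + 10 * L + a′ * (12 + 8 * L)
  smrColumns-length = trans (length-++ (columns L base)) (cong₂ _+_
    (trans (length-columns {L} base 0) (ℕ.+-identityʳ _))
    (trans (length-concat-replicate a′ _) (cong (a′ *_) (trans (length-columns {L} layer 0) (ℕ.+-identityʳ _)))))

  smrColumns-regular : ∀ ρ →
    degree (incidence plus ρ) smrColumns + degree (incidence minus ρ) smrColumns ≡ 5 + a′ * 4
  smrColumns-regular ρ = begin
    degree (incidence plus ρ) smrColumns + degree (incidence minus ρ) smrColumns
      ≡⟨ cong₂ _+_ (degree-smrColumns plus) (degree-smrColumns minus) ⟩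
    (B plus + a′ * Y plus) + (B minus + a′ * Y minus)
      ≡⟨ regroup (B plus) (B minus) (Y plus) (Y minus) a′ ⟩
    (B plus + B minus) + a′ * (Y plus + Y minus)
      ≡⟨ cong₂ (λ b y → b + a′ * y) (base-degree ρ) (layer-degree ρ) ⟩
    5 + a′ * 4 ∎
    where
    open ≡-Reasoning
    B Y : Polarity → ℕ
    B s = degree (symbolicDegree s ρ) base
    Y s = degree (symbolicDegree s ρ) layer
    degree-smrColumns : ∀ s → degree (incidence s ρ) smrColumns ≡ B s + a′ * Y s
    degree-smrColumns s = trans (degree-++ _ (columns L base) _) (cong₂ _+_ (degree-columns s ρ base)
      (trans (degree-concat-replicate _ a′ _) (cong (a′ *_) (degree-columns s ρ layer))))
    regroup : ∀ b b′ y y′ k → (b + k * y) + (b′ + k * y′) ≡ (b + b′) + k * (y + y′)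
    regroup = solve-∀

  smrColumns-balanced : ∀ ρ →
    labelSum (incidence plus ρ) 0 smrColumns ≡ labelSum (incidence minus ρ) 0 smrColumns
  smrColumns-balanced ρ = begin
    labelSum (incidence plus ρ) 0 smrColumns
      ≡⟨ labelSum-++ _ 0 (columns L base) _ ⟩
    labelSum (incidence plus ρ) 0 (columns L base) + labelSum (incidence plus ρ) (length (columns L base)) layers
      ≡⟨ cong₂ _+_ (columns-balanced base (num 0) (base-balanced ρ))
           (labelSum-concat-replicate (columns L layer) layer-balanced-everywhere a′ _) ⟩
    labelSum (incidence minus ρ) 0 (columns L base) + labelSum (incidence minus ρ) (length (columns L base)) layers
      ≡⟨ sym (labelSum-++ _ 0 (columns L base) _) ⟩
    labelSum (incidence minus ρ) 0 smrColumns ∎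
    where
    open ≡-Reasoning
    layers : List (Column (Row L))
    layers = concat (replicate a′ (columns L layer))
    t : ℕ
    t = blockIndex ρ
    columns-balanced : ∀ σs o → symbolicLabelSums plus ρ o σs ≡ symbolicLabelSums minus ρ o σs →
      labelSum (incidence plus ρ) (⟦ o ⟧ L t) (columns L σs) ≡
      labelSum (incidence minus ρ) (⟦ o ⟧ L t) (columns L σs)
    columns-balanced σs o eq = trans (labelSum-columns plus ρ o σs)
      (trans (cong (λ f → ⟦ f ⟧ L t) eq) (sym (labelSum-columns minus ρ o σs)))
    layer-balanced-everywhere : ∀ o →
      labelSum (incidence plus ρ) o (columns L layer) ≡ labelSum (incidence minus ρ) o (columns L layer)
    layer-balanced-everywhere o =
      subst (λ p → labelSum (incidence plus ρ) p (columns L layer) ≡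
                   labelSum (incidence minus ρ) p (columns L layer))
        (⟦num⟧ o L t) (columns-balanced layer (num o) (layer-balanced ρ (num o)))

SMR-resize : ∀ {m m′ n n′ r r′ s} → m ≡ m′ → n ≡ n′ → r ≡ r′ → SMR m n r s → SMR m′ n′ r′ s
SMR-resize refl refl refl A = A

lemma19 : (a b : ℕ) → a ≥ 1 → b ≥ 1 →
    SMR (4 * b + 2) ((4 * a + 1) * (2 * b + 1)) (4 * a + 1) 2
lemma19 (suc a′) (suc L) _ _ =
  SMR-resize (rows-count L) (trans (smrColumns-length L a′) (columns-count L a′)) (degree-count a′)
    (columns⇒SMR rows (5 + a′ * 4) (smrColumns L a′) (smrColumns-loopless L a′)
      (smrColumns-regular L a′) (smrColumns-balanced L a′)
      (trans (double-count L a′) (cong (_* 2) (sym (smrColumns-length L a′)))))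
  where
  rows-count : ∀ L → 6 + L * 4 ≡ 4 * suc L + 2
  rows-count = solve-∀
  columns-count : ∀ L a′ → 15 + 10 * L + a′ * (12 + 8 * L) ≡ (4 * suc a′ + 1) * (2 * suc L + 1)
  columns-count = solve-∀
  degree-count : ∀ a′ → 5 + a′ * 4 ≡ 4 * suc a′ + 1
  degree-count = solve-∀
  double-count : ∀ L a′ → (6 + L * 4) * (5 + a′ * 4) ≡ (15 + 10 * L + a′ * (12 + 8 * L)) * 2
  double-count = solve-∀
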